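{- Let $G$ be a simple graph with vertex set $[d]=\{1,\dots,d\}$, let $\pi=a_1a_2\cdots a_d\in\mathcal S_d$, and let $S_1,S_2,\ldots,S_k$ be the $G$-sequence of $\pi$. If $a_m,a_{m+1}\in S_i$ for some $i$, then either $\ell(m)>\ell(m+1)$, or else $\ell(m)=\ell(m+1)$ and $a_m>a_{m+1}$. Moreover, each $S_i$ is a stable set in $G$, i.e. no two vertices of $S_i$ are adjacent in $G$.
   Context: $G$ is a simple graph (no loops, no multiple edges) with vertex set $[d]$. A path of length $r$ in $G$ is a sequence of vertices $v_0,v_1,\dots,v_r$ with $v_{s-1}$ adjacent to $v_s$ for each $s\in[r]$. For a permutation $\pi=a_1a_2\cdots a_d$ of $[d]$ (written in one-line notation) and $k\in[d]$, $\ell(k)$ denotes the largest $r\ge 0$ such that there are indices $i_0<i_1<\cdots<i_r=k$ with $a_{i_0},a_{i_1},\dots,a_{i_r}$ a path in $G$ (the length of the longest path in $G$ ending in $a_k$ whose vertices occur in $\pi$ in increasing positions). An integer $k\in\{0,1,\dots,d-1\}$ is a cut of $\pi$ (with respect to $G$) if $k=0$, or $\ell(k)<\ell(k+1)$, or $\ell(k)=\ell(k+1)$ and $a_k<a_{k+1}$. If the cuts of $\pi$ are $0=i_1<i_2<\cdots<i_k$, the $G$-sequence of $\pi$ is $S_1,\dots,S_k$ where $S_j=\{a_{i_j+1},a_{i_j+2},\dots,a_{i_{j+1}}\}$ for $j<k$ and $S_k=\{a_{i_k+1},\dots,a_d\}$. -}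

module Defs where

open import Data.Nat using (ℕ; zero; suc; _≤_) renaming (_<_ to _<ℕ_; _<ᵇ_ to _<ᵇℕ_; _≡ᵇ_ to _≡ᵇℕ_)
open import Data.Fin using (Fin; toℕ; _<_)
open import Data.Fin.Permutation using (Permutation′; _⟨$⟩ʳ_)
open import Data.Bool using (Bool; true; false; if_then_else_; _∨_; _∧_)
open import Data.List using (List; []; _∷_; _++_; [_]; map; allFin)
open import Data.Product using (_×_; _,_)
open import Relation.Binary.PropositionalEquality using (_≡_)

-- A simple graph on vertex set Fin d (= [d], relabelled 0..d-1, order preserved):
-- decidable, symmetric, irreflexive adjacency.
record SimpleGraph (d : ℕ) : Set where
  field
    adj    : Fin d → Fin d → Bool
    sym    : ∀ u v → adj u v ≡ adj v u
    irrefl : ∀ v → adj v v ≡ false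
open SimpleGraph public

module _ {d : ℕ} (G : SimpleGraph d) (π : Permutation′ d) where

  -- a p : the entry of π at position p (positions 0-indexed: Fin d)
  entry : Fin d → Fin d
  entry p = π ⟨$⟩ʳ p

  -- IncPath r k : a path v_0,...,v_r in G with v_s = a_{i_s}, i_0 < ... < i_r = k
  data IncPath : ℕ → Fin d → Set where
    start : ∀ k → IncPath 0 k
    step  : ∀ {r j k} → IncPath r j → j < k → adj G (entry j) (entry k) ≡ true
          → IncPath (suc r) k

  IsEll : (Fin d → ℕ) → Set
  IsEll ℓ = ∀ k → IncPath (ℓ k) k × (∀ r → IncPath r k → r ≤ ℓ k)

  module _ (ℓ : Fin d → ℕ) where

    cutᵇ : Fin d × ℕ → Fin d × ℕ → Bool
    cutᵇ (v , l) (w , l') = (l <ᵇℕ l') ∨ ((l ≡ᵇℕ l') ∧ (toℕ v <ᵇℕ toℕ w))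

    private
      go : Fin d × ℕ → List (Fin d) → List (Fin d × ℕ) → List (List (Fin d))
      go prev cur [] = cur ∷ []
      go prev cur ((w , l) ∷ ys) =
        if cutᵇ prev (w , l) then cur ∷ go (w , l) [ w ] ys
                             else go (w , l) (cur ++ [ w ]) ys

      blocks : List (Fin d × ℕ) → List (List (Fin d))
      blocks [] = []
      blocks ((v , l) ∷ xs) = go (v , l) [ v ] xs

    -- The G-sequence S_1,...,S_k of π: the entries a_1 ... a_d split at the cuts
    -- (position 0 is always a cut; each S_j is given as the list of its elements).
    GSeq : List (List (Fin d))
    GSeq = blocks (map (λ p → entry p , ℓ p) (allFin d))

{-# OPTIONS --safe #-}
module Submission where

open import Level using (Level)
open import Data.Bool using (Bool; true; false; if_then_else_)
open import Data.Bool.Properties using (¬-not)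
open import Data.Empty using (⊥-elim)
open import Data.Fin using (Fin; toℕ; _<_; _>_; _≤_)
open import Data.Fin.Permutation using (Permutation′)
import Data.Fin.Properties as Fin
open import Data.List using (List; []; _∷_; [_]; _∷ʳ_; map; tabulate; allFin)
open import Data.List.Properties using (map-++)
open import Data.List.Membership.Propositional using (_∈_)
open import Data.List.Membership.Propositional.Properties using (∈-map⁻)
import Data.List.Relation.Unary.All as All
open import Data.List.Relation.Unary.Any using (here; there)
open import Data.List.Relation.Unary.AllPairs using (AllPairs; _∷_)
import Data.List.Relation.Unary.AllPairs as AllPairs
import Data.List.Relation.Unary.AllPairs.Properties as AllPairs
open import Data.List.Relation.Unary.Linked using (Linked; []; [-]; _∷_)
import Data.List.Relation.Unary.Linked as Linked
open import Data.List.Relation.Unary.Linked.Properties using (Linked⇒AllPairs)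
open import Data.Nat using (ℕ; suc) renaming (_<_ to _<ℕ_; _≤_ to _≤ℕ_; _<ᵇ_ to _<ᵇℕ_; _≡ᵇ_ to _≡ᵇℕ_)
open import Data.Nat.Properties using (≡ᵇ⇒≡; ≡⇒≡ᵇ; <ᵇ-reflects-<; ≮⇒≥)
import Data.Nat.Properties as ℕ
open import Data.Product using (_×_; _,_; proj₁; proj₂; ∃-syntax)
import Data.Product as Product
open import Data.Sum using (_⊎_; inj₁; inj₂)
import Data.Sum as Sum
open import Function using (_∘_; flip; Injection)
open import Function.Properties.Inverse using (↔⇒↣)
open import Relation.Binary.Core using (Rel)
open import Relation.Binary.Definitions using (Reflexive; Symmetric)
open import Relation.Binary.Construct.Intersection using (_∩_)
open import Relation.Binary.PropositionalEquality using (_≡_; refl; sym; trans; cong; subst)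
open import Relation.Nullary.Reflects using (ofʸ; ofⁿ; fromEquivalence)

open import Defs using (SimpleGraph; adj; irrefl; entry; step; IsEll; cutᵇ; GSeq)

-- A block of the G-sequence is the image of a run k, k+1, …, k' of consecutive positions with no
-- cut between neighbours, and "no cut between k and k+1" is literally the first claim. In
-- particular ℓ is non-increasing along a block. An edge a_i a_j with i < j would extend a longest
-- path ending at a_i, forcing ℓ(i) < ℓ(j); so two vertices of one block are never adjacent.

private
  variable
    a r : Level
    A : Set a
    n : ℕ

Consecutive : Rel (Fin n) _
Consecutive i j = toℕ j ≡ suc (toℕ i)

module _ {R : Rel A r} where

  Linked-∷ʳ⁺ : ∀ xs {x y} → Linked R (xs ∷ʳ x) → R x y → Linked R (xs ∷ʳ x ∷ʳ y)
  Linked-∷ʳ⁺ []           [-]         Rxy = Rxy ∷ [-]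
  Linked-∷ʳ⁺ (_ ∷ [])     (Rwx ∷ Rxs) Rxy = Rwx ∷ Linked-∷ʳ⁺ [] Rxs Rxy
  Linked-∷ʳ⁺ (_ ∷ _ ∷ xs) (Rwv ∷ Rxs) Rxy = Rwv ∷ Linked-∷ʳ⁺ (_ ∷ xs) Rxs Rxy

  Linked-tabulate⁺ : ∀ {f : Fin n → A} → (∀ {i j} → Consecutive i j → R (f i) (f j)) → Linked R (tabulate f)
  Linked-tabulate⁺ {n = 0}               Rf = []
  Linked-tabulate⁺ {n = 1}               Rf = [-]
  Linked-tabulate⁺ {n = suc (suc n)} {f} Rf = Rf refl ∷ Linked-tabulate⁺ {f = f ∘ Fin.suc} (Rf ∘ cong suc)

  AllPairs⇒∈-related : Symmetric R → Reflexive R → ∀ {xs x y} → AllPairs R xs → x ∈ xs → y ∈ xs → R x y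
  AllPairs⇒∈-related R-sym R-refl _         (here refl) (here refl) = R-refl
  AllPairs⇒∈-related R-sym R-refl (Rx ∷ _)  (here refl) (there y∈)  = All.lookup Rx y∈
  AllPairs⇒∈-related R-sym R-refl (Rx ∷ _)  (there x∈)  (here refl) = R-sym (All.lookup Rx x∈)
  AllPairs⇒∈-related R-sym R-refl (_ ∷ Rxs) (there x∈)  (there y∈)  = AllPairs⇒∈-related R-sym R-refl Rxs x∈ y∈

allFin-consecutive : Linked Consecutive (allFin n)
allFin-consecutive = Linked-tabulate⁺ (λ c → c)

Consecutive⇒< : ∀ {i j : Fin n} → Consecutive i j → i < j
Consecutive⇒< c = ℕ.≤-reflexive (sym c)

Linked-consecutive⇒sorted : ∀ {xs : List (Fin n)} → Linked Consecutive xs → AllPairs _<_ xs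
Linked-consecutive⇒sorted = Linked⇒AllPairs Fin.<-trans ∘ Linked.map Consecutive⇒<

module _ {P : Rel (Fin n) r} where

  private
    ∈-consecutive : ∀ {xs i j} → Linked (Consecutive ∩ P) xs → AllPairs _<_ xs
                  → i ∈ xs → j ∈ xs → Consecutive i j → P i j
    ∈-consecutive _               _            (here refl) (here refl)         c =
      ⊥-elim (Fin.<-irrefl refl (Consecutive⇒< c))
    ∈-consecutive ((_ , Pab) ∷ _) _            (here refl) (there (here refl)) _ = Pab
    ∈-consecutive ((cab , _) ∷ _) (_ ∷ b< ∷ _) (here refl) (there (there j∈))  c =
      ⊥-elim (ℕ.<-irrefl (trans cab (sym c)) (All.lookup b< j∈))
    ∈-consecutive _               (a< ∷ _)     (there i∈)  (here refl)         c =
      ⊥-elim (Fin.<-asym (All.lookup a< i∈) (Consecutive⇒< c))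
    ∈-consecutive lk              (_ ∷ sorted) (there i∈)  (there j∈)          c =
      ∈-consecutive (Linked.tail lk) sorted i∈ j∈ c

  Linked-consecutive-∈ : ∀ {xs i j} → Linked (Consecutive ∩ P) xs → i ∈ xs → j ∈ xs → Consecutive i j → P i j
  Linked-consecutive-∈ lk = ∈-consecutive lk (Linked-consecutive⇒sorted (Linked.map proj₁ lk))

module Runs {X A B : Set} (h : X → A) (key : A → B) (cut : A → A → Bool) where

  SplitsAtCuts : (A → List B → List A → List (List B)) → Set
  SplitsAtCuts F = (∀ p c → F p c [] ≡ [ c ])
                 × (∀ p c x ys → F p c (x ∷ ys) ≡ (if cut p x then c ∷ F x [ key x ] ys else F x (c ∷ʳ key x) ys))

  Uncut : Rel X _
  Uncut i j = cut (h i) (h j) ≡ false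

  IsRun : Rel X r → List B → Set _
  IsRun R S = ∃[ seg ] S ≡ map (key ∘ h) seg × Linked (R ∩ Uncut) seg

  ∈-split : ∀ {F} → SplitsAtCuts F → ∀ {R : Rel X r} cs q ys → Linked (R ∩ Uncut) (cs ∷ʳ q) → Linked R (q ∷ ys)
          → ∀ {S} → S ∈ F (h q) (map (key ∘ h) (cs ∷ʳ q)) (map h ys) → IsRun R S
  ∈-split (F-[] , _) cs q [] lk _ mem with subst (_ ∈_) (F-[] _ _) mem
  ... | here refl = cs ∷ʳ q , refl , lk
  ∈-split {F = F} split@(_ , F-∷) cs q (y ∷ ys) lk (Rqy ∷ Rys) mem
    with cut (h q) (h y) in cut≡ | subst (_ ∈_) (F-∷ _ _ _ _) mem
  ... | true  | here refl  = cs ∷ʳ q , refl , lk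
  ... | true  | there mem′ = ∈-split {F = F} split [] y ys [-] Rys mem′
  ... | false | mem′       = ∈-split {F = F} split (cs ∷ʳ q) y ys (Linked-∷ʳ⁺ cs lk (Rqy , cut≡)) Rys
                               (subst (λ c → _ ∈ F (h y) c (map h ys)) (sym (map-++ (key ∘ h) (cs ∷ʳ q) [ y ])) mem′)

module _ {d} (G : SimpleGraph d) where

  Nonadjacent : Rel (Fin d) _
  Nonadjacent u v = adj G u v ≡ false

  Nonadjacent-sym : Symmetric Nonadjacent
  Nonadjacent-sym {u} {v} uv = trans (SimpleGraph.sym G v u) uv

module _ {d} (G : SimpleGraph d) (π : Permutation′ d) (ℓ : Fin d → ℕ) where

  private
    e : Fin d → Fin d
    e = entry G π

    h : Fin d → Fin d × ℕ
    h p = e p , ℓ p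

  open Runs h proj₁ (cutᵇ G π ℓ)

  private
    ∈-split-from : ∀ {F} → SplitsAtCuts F → ∀ {p c ys S} → S ∈ F p c ys
                 → ∀ {x xs} → Linked Consecutive (x ∷ xs) → h x ≡ p → [ e x ] ≡ c → map h xs ≡ ys
                 → IsRun Consecutive S
    ∈-split-from {F} split mem lk refl refl refl = ∈-split {F = F} split [] _ _ [-] lk mem

  -- The splitting helper behind GSeq is private to Defs. Abstracting its arguments to variables
  -- p c ys lets unification solve the top-level meta splitAtCuts as that helper; a meta local to
  -- the clause would have p c ys in its context as well, and the problem would not be a pattern.
  mutual
    private
      splitAtCuts : Fin d × ℕ → List (Fin d) → List (Fin d × ℕ) → List (List (Fin d))
      splitAtCuts = _

    GSeq-run : ∀ {S} → S ∈ GSeq G π ℓ → IsRun Consecutive S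
    GSeq-run {S} mem with allFin d | allFin-consecutive {d} | mem
    ... | x ∷ xs | lk | mem′ with h x in p≡ | [ e x ] in c≡ | map h xs in ys≡ | mem′
    ...   | p | c | ys | mem″ =
      ∈-split-from {F = splitAtCuts} ((λ _ _ → refl) , (λ _ _ _ _ → refl)) mem″ lk p≡ c≡ ys≡

  Uncut⇒ : ∀ {i j} → Uncut i j → ℓ j <ℕ ℓ i ⊎ (ℓ i ≡ ℓ j × e j ≤ e i)
  Uncut⇒ {i} {j} uncut
    with ℓ i <ᵇℕ ℓ j | <ᵇ-reflects-< (ℓ i) (ℓ j) | ℓ i ≡ᵇℕ ℓ j | fromEquivalence (≡ᵇ⇒≡ (ℓ i) (ℓ j)) (≡⇒≡ᵇ (ℓ i) (ℓ j))
       | toℕ (e i) <ᵇℕ toℕ (e j) | <ᵇ-reflects-< (toℕ (e i)) (toℕ (e j))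
  Uncut⇒ () | true  | _ | _    | _ | _    | _
  Uncut⇒ () | false | _ | true | _ | true | _
  ... | false | ofⁿ ℓi≮ℓj | false | ofⁿ ℓi≢ℓj | _     | _          = inj₁ (ℕ.≤∧≢⇒< (≮⇒≥ ℓi≮ℓj) (ℓi≢ℓj ∘ sym))
  ... | false | ofⁿ _     | true  | ofʸ ℓi≡ℓj | false | ofⁿ ei≮ej = inj₂ (ℓi≡ℓj , ≮⇒≥ ei≮ej)

  Uncut⇒ℓ≥ : ∀ {i j} → Uncut i j → ℓ j ≤ℕ ℓ i
  Uncut⇒ℓ≥ = Sum.[ ℕ.<⇒≤ , ℕ.≤-reflexive ∘ sym ∘ proj₁ ] ∘ Uncut⇒

  entry-injective : ∀ {i j} → e i ≡ e j → i ≡ j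
  entry-injective = Injection.injective (↔⇒↣ π)

  ∈-map-entry⁻ : ∀ {i xs} → e i ∈ map e xs → i ∈ xs
  ∈-map-entry⁻ mem with ∈-map⁻ e mem
  ... | _ , j∈ , eq rewrite entry-injective eq = j∈

  run-consecutive : ∀ {S m m′} → IsRun Consecutive S → Consecutive m m′ → e m ∈ S → e m′ ∈ S
                  → ℓ m′ <ℕ ℓ m ⊎ (ℓ m ≡ ℓ m′ × e m > e m′)
  run-consecutive {m = m} {m′} (seg , refl , lk) c m∈ m′∈ =
    Sum.map₂ (Product.map₂ strict) (Uncut⇒ (Linked-consecutive-∈ lk (∈-map-entry⁻ m∈) (∈-map-entry⁻ m′∈) c))
    where
      strict : e m′ ≤ e m → e m > e m′
      strict le = Fin.≤∧≢⇒< le (Fin.<⇒≢ (Consecutive⇒< c) ∘ sym ∘ entry-injective)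

  edge⇒ℓ< : IsEll G π ℓ → ∀ {i j} → i < j → adj G (e i) (e j) ≡ true → ℓ i <ℕ ℓ j
  edge⇒ℓ< isEll {i} {j} i<j ij = proj₂ (isEll j) _ (step (proj₁ (isEll i)) i<j ij)

  run-nonadjacent : IsEll G π ℓ → ∀ {S} → IsRun Consecutive S → AllPairs (Nonadjacent G) S
  run-nonadjacent isEll (seg , refl , lk) = AllPairs.map⁺ (AllPairs.zipWith nonadjacent (sorted , ℓ-nonincreasing))
    where
      sorted : AllPairs _<_ seg
      sorted = Linked-consecutive⇒sorted (Linked.map proj₁ lk)

      ℓ-nonincreasing : AllPairs (λ i j → ℓ j ≤ℕ ℓ i) seg
      ℓ-nonincreasing = Linked⇒AllPairs (flip ℕ.≤-trans) (Linked.map (Uncut⇒ℓ≥ ∘ proj₂) lk)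

      nonadjacent : ∀ {i j} → i < j × ℓ j ≤ℕ ℓ i → Nonadjacent G (e i) (e j)
      nonadjacent (i<j , ℓj≤ℓi) = ¬-not (λ ij → ℕ.<⇒≱ (edge⇒ℓ< isEll i<j ij) ℓj≤ℓi)

lemma1p4 : ∀ {d : ℕ} (G : SimpleGraph d) (π : Permutation′ d) (ℓ : Fin d → ℕ)
           → IsEll G π ℓ
           → (∀ (m m′ : Fin d) → toℕ m′ ≡ suc (toℕ m) → ∀ S → S ∈ GSeq G π ℓ
                → entry G π m ∈ S → entry G π m′ ∈ S
                → (ℓ m′ <ℕ ℓ m) ⊎ ((ℓ m ≡ ℓ m′) × (entry G π m > entry G π m′)))
           × (∀ S → S ∈ GSeq G π ℓ → ∀ u v → u ∈ S → v ∈ S → adj G u v ≡ false)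
lemma1p4 G π ℓ isEll =
  (λ m m′ m′≡1+m S S∈ m∈ m′∈ → run-consecutive G π ℓ (GSeq-run G π ℓ S∈) m′≡1+m m∈ m′∈) ,
  (λ S S∈ u v u∈ v∈ →
     AllPairs⇒∈-related (Nonadjacent-sym G) (irrefl G _) (run-nonadjacent G π ℓ isEll (GSeq-run G π ℓ S∈)) u∈ v∈)
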